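{- The win-lose bimatrix game $\widehat{\mathsf{G}}_4$ has no symmetric Nash equilibrium.
   Context: $\widehat{\mathsf{G}}_4$ is the bimatrix game with strategy set $\{1,2,3\}$ for both players and utility vectors $\langle\mathsf U_1,\mathsf U_2\rangle$: $\langle1,1\rangle\mapsto\langle1,0\rangle$, $\langle1,2\rangle\mapsto\langle0,1\rangle$, $\langle1,3\rangle\mapsto\langle1,0\rangle$, $\langle2,1\rangle\mapsto\langle0,1\rangle$, $\langle2,2\rangle\mapsto\langle0,0\rangle$, $\langle2,3\rangle\mapsto\langle1,0\rangle$, $\langle3,1\rangle\mapsto\langle0,1\rangle$, $\langle3,2\rangle\mapsto\langle1,0\rangle$, $\langle3,3\rangle\mapsto\langle0,1\rangle$. Nash equilibria are mixed; a mixed profile $\langle\sigma_1,\sigma_2\rangle$ is symmetric if $\sigma_1=\sigma_2$.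
   Formalization: Mixed strategies, including the deviations in the equilibrium condition, take rational probabilities rather than real ones. -}

module Defs where

open import Data.Fin using (Fin; zero; suc)
open import Data.Rational using (ℚ; 0ℚ; 1ℚ; _+_; _*_; _≤_)
open import Data.Product using (_×_)
open import Relation.Binary.PropositionalEquality using (_≡_)

Strategy : Set
Strategy = Fin 3

s1 s2 s3 : Strategy
s1 = zero
s2 = suc zero
s3 = suc (suc zero)

Σ₃ : (Strategy → ℚ) → ℚ
Σ₃ f = f s1 + (f s2 + f s3)

-- Utility of player 1 in Ĝ₄ (row strategy first, column strategy second).
U₁ : Strategy → Strategy → ℚ
U₁ zero zero = 1ℚ
U₁ zero (suc zero) = 0ℚ
U₁ zero (suc (suc zero)) = 1ℚ
U₁ (suc zero) zero = 0ℚ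
U₁ (suc zero) (suc zero) = 0ℚ
U₁ (suc zero) (suc (suc zero)) = 1ℚ
U₁ (suc (suc zero)) zero = 0ℚ
U₁ (suc (suc zero)) (suc zero) = 1ℚ
U₁ (suc (suc zero)) (suc (suc zero)) = 0ℚ

U₂ : Strategy → Strategy → ℚ
U₂ zero zero = 0ℚ
U₂ zero (suc zero) = 1ℚ
U₂ zero (suc (suc zero)) = 0ℚ
U₂ (suc zero) zero = 1ℚ
U₂ (suc zero) (suc zero) = 0ℚ
U₂ (suc zero) (suc (suc zero)) = 0ℚ
U₂ (suc (suc zero)) zero = 1ℚ
U₂ (suc (suc zero)) (suc zero) = 0ℚ
U₂ (suc (suc zero)) (suc (suc zero)) = 1ℚ

record Mixed : Set where
  field
    prob    : Strategy → ℚ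
    nonneg  : ∀ s → 0ℚ ≤ prob s
    sums-to-1 : Σ₃ prob ≡ 1ℚ

open Mixed public

expU : (Strategy → Strategy → ℚ) → Mixed → Mixed → ℚ
expU U σ₁ σ₂ = Σ₃ (λ i → Σ₃ (λ j → (prob σ₁ i * prob σ₂ j) * U i j))

IsNash : Mixed → Mixed → Set
IsNash σ₁ σ₂ =
  (∀ (τ : Mixed) → expU U₁ τ σ₂ ≤ expU U₁ σ₁ σ₂) ×
  (∀ (τ : Mixed) → expU U₂ σ₁ τ ≤ expU U₂ σ₁ σ₂)

{-# OPTIONS --safe #-}
-- Write σ = (a, b, c) and s = a + c. The two payoffs at (σ, σ) add up to s (s + 2b).
-- Deviating to strategy 1 earns player 1 exactly s, while player 2's payoffs from
-- strategies 1 and 2, namely b + c and a, add up to 1; so at an equilibrium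
-- 2s + 1 ≤ 2s (s + 2b). But when s + b = 1, 2 (2s + 1) − 4s (s + 2b) = 1 + (s − b)² > 0.
module Submission where

open import Algebra.Bundles using (CommutativeMonoid)
open import Data.Fin using (Fin; zero; suc)
open import Data.Product using (_,_)
open import Data.Rational using (ℚ; 0ℚ; 1ℚ; _+_; _*_; _-_; _≤_; _<_; nonNegative; nonPositive)
open import Data.Rational.Properties
open import Data.Rational.Solver using (module +-*-Solver)
open import Data.Sum using (inj₁; inj₂)
open import Data.Vec using (tabulate)
open import Relation.Binary.PropositionalEquality using (_≡_; refl; sym; trans; cong; cong₂; subst)
open import Relation.Nullary using (¬_)

open import Algebra.Properties.CommutativeSemigroup
  (CommutativeMonoid.commutativeSemigroup +-0-commutativeMonoid) using (interchange)
open +-*-Solver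

open import Defs

square-nonNeg : ∀ p → 0ℚ ≤ p * p
square-nonNeg p with ≤-total 0ℚ p
... | inj₁ 0≤p = nonNegative⁻¹ (p * p)
  {{nonNeg*nonNeg⇒nonNeg p {{nonNegative 0≤p}} p {{nonNegative 0≤p}}}}
... | inj₂ p≤0 = nonNegative⁻¹ (p * p)
  {{nonPos*nonPos⇒nonPos p {{nonPositive p≤0}} p {{nonPositive p≤0}}}}

0<1+p*p : ∀ p → 0ℚ < 1ℚ + p * p
0<1+p*p p = begin-strict
  0ℚ          <⟨ positive⁻¹ 1ℚ ⟩
  1ℚ          ≡⟨ sym (+-identityʳ 1ℚ) ⟩
  1ℚ + 0ℚ     ≤⟨ +-monoʳ-≤ 1ℚ (square-nonNeg p) ⟩
  1ℚ + p * p  ∎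
  where open ≤-Reasoning

δ : ∀ {n} → Fin n → Fin n → ℚ
δ zero    zero    = 1ℚ
δ (suc i) (suc j) = δ i j
δ _       _       = 0ℚ

δ-nonNeg : ∀ {n} (i j : Fin n) → 0ℚ ≤ δ i j
δ-nonNeg zero    zero    = nonNegative⁻¹ 1ℚ
δ-nonNeg zero    (suc j) = ≤-refl
δ-nonNeg (suc i) zero    = ≤-refl
δ-nonNeg (suc i) (suc j) = δ-nonNeg i j

Σ₃-δ : ∀ i → Σ₃ (δ i) ≡ 1ℚ
Σ₃-δ zero             = refl
Σ₃-δ (suc zero)       = refl
Σ₃-δ (suc (suc zero)) = refl

pure : Strategy → Mixed
pure i = record { prob = δ i ; nonneg = δ-nonNeg i ; sums-to-1 = Σ₃-δ i }

-- expU transcribed into the solver's syntax: in the environment tabulate (prob σ),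
-- expUᴾ U var var unfolds definitionally to expU U σ σ (and pureᴾ i to prob (pure i)),
-- which is what lets the solver expand payoffs.
Σ₃ᴾ : (Strategy → Polynomial 3) → Polynomial 3
Σ₃ᴾ f = f s1 :+ (f s2 :+ f s3)

expUᴾ : (Strategy → Strategy → ℚ) →
        (Strategy → Polynomial 3) → (Strategy → Polynomial 3) → Polynomial 3
expUᴾ U p q = Σ₃ᴾ (λ i → Σ₃ᴾ (λ j → (p i :* q j) :* con (U i j)))

pureᴾ : Strategy → Strategy → Polynomial 3
pureᴾ i j = con (δ i j)

expU₁-pure-s1 : ∀ σ → expU U₁ (pure s1) σ ≡ prob σ s1 + prob σ s3
expU₁-pure-s1 σ = prove (tabulate (prob σ)) (expUᴾ U₁ (pureᴾ s1) var) (var s1 :+ var s3) refl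

expU₂-pure-s1 : ∀ σ → expU U₂ σ (pure s1) ≡ prob σ s2 + prob σ s3
expU₂-pure-s1 σ = prove (tabulate (prob σ)) (expUᴾ U₂ var (pureᴾ s1)) (var s2 :+ var s3) refl

expU₂-pure-s2 : ∀ σ → expU U₂ σ (pure s2) ≡ prob σ s1
expU₂-pure-s2 σ = prove (tabulate (prob σ)) (expUᴾ U₂ var (pureᴾ s2)) (var s1) refl

expU₁+expU₂-diagonal : ∀ σ → let a = prob σ s1; b = prob σ s2; c = prob σ s3 in
  expU U₁ σ σ + expU U₂ σ σ ≡ (a + c) * ((a + c) + (b + b))
expU₁+expU₂-diagonal σ = prove (tabulate (prob σ))
  (expUᴾ U₁ var var :+ expUᴾ U₂ var var)
  ((var s1 :+ var s3) :* ((var s1 :+ var s3) :+ (var s2 :+ var s2))) refl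

symmetricNash⇒2[a+c]+1≤2[a+c][a+c+2b] : ∀ σ → IsNash σ σ →
  let a = prob σ s1; b = prob σ s2; c = prob σ s3; s = a + c in
  (s + s) + 1ℚ ≤ s * (s + (b + b)) + s * (s + (b + b))
symmetricNash⇒2[a+c]+1≤2[a+c][a+c+2b] σ (no-gain₁ , no-gain₂) = begin
  (s + s) + 1ℚ               ≡⟨ cong ((s + s) +_) (sym (sums-to-1 σ)) ⟩
  (s + s) + (a + (b + c))    ≡⟨ cong ((s + s) +_) (+-comm a (b + c)) ⟩
  (s + s) + ((b + c) + a)    ≤⟨ +-mono-≤ (+-mono-≤ gain₁ gain₁) (+-mono-≤ gain₂ gain₂′) ⟩
  (v₁ + v₁) + (v₂ + v₂)      ≡⟨ interchange v₁ v₁ v₂ v₂ ⟩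
  (v₁ + v₂) + (v₁ + v₂)      ≡⟨ cong₂ _+_ (expU₁+expU₂-diagonal σ) (expU₁+expU₂-diagonal σ) ⟩
  s * (s + (b + b)) + s * (s + (b + b)) ∎
  where
  open ≤-Reasoning
  a = prob σ s1
  b = prob σ s2
  c = prob σ s3
  s = a + c
  v₁ = expU U₁ σ σ
  v₂ = expU U₂ σ σ
  gain₁ : s ≤ v₁
  gain₁ = subst (_≤ v₁) (expU₁-pure-s1 σ) (no-gain₁ (pure s1))
  gain₂ : b + c ≤ v₂
  gain₂ = subst (_≤ v₂) (expU₂-pure-s1 σ) (no-gain₂ (pure s1))
  gain₂′ : a ≤ v₂
  gain₂′ = subst (_≤ v₂) (expU₂-pure-s2 σ) (no-gain₂ (pure s2))

2[a+c]+1≰2[a+c][a+c+2b] : ∀ a b c → a + (b + c) ≡ 1ℚ → let s = a + c in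
  ¬ ((s + s) + 1ℚ ≤ s * (s + (b + b)) + s * (s + (b + b)))
2[a+c]+1≰2[a+c][a+c+2b] a b c a+b+c≡1 2s+1≤2S = <-irrefl refl (begin-strict
  (s + s + 1ℚ) + (s + s + 1ℚ)    ≤⟨ +-mono-≤ 2s+1≤2S 2s+1≤2S ⟩
  4S                             ≡⟨ sym (+-identityʳ 4S) ⟩
  4S + 0ℚ                        <⟨ +-monoʳ-< 4S (0<1+p*p (s - b)) ⟩
  4S + (1ℚ + (s - b) * (s - b))  ≡⟨ sym gap ⟩
  (s + s + 1ℚ) + (s + s + 1ℚ)    ∎)
  where
  open ≤-Reasoning
  s = a + c
  S = s * (s + (b + b))
  4S = (S + S) + (S + S)
  t = a + (b + c)
  -- Homogenised with t = a + b + c so that it is a ring identity; t = 1 is put in afterwards.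
  homogeneous-gap : ((s + s + t) + (s + s + t)) * t ≡ 4S + (t * t + (s - b) * (s - b))
  homogeneous-gap = solve 3
    (λ a b c → let s = a :+ c; t = a :+ (b :+ c); S = s :* (s :+ (b :+ b)) in
      ((s :+ s :+ t) :+ (s :+ s :+ t)) :* t
        := ((S :+ S) :+ (S :+ S)) :+ (t :* t :+ (s :- b) :* (s :- b)))
    refl a b c
  gap : (s + s + 1ℚ) + (s + s + 1ℚ) ≡ 4S + (1ℚ + (s - b) * (s - b))
  gap = trans (sym (*-identityʳ _)) (subst
    (λ t → ((s + s + t) + (s + s + t)) * t ≡ 4S + (t * t + (s - b) * (s - b)))
    a+b+c≡1 homogeneous-gap)

mainTheorem13 : (σ : Mixed) → ¬ IsNash σ σ
mainTheorem13 σ nash =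
  2[a+c]+1≰2[a+c][a+c+2b] (prob σ s1) (prob σ s2) (prob σ s3) (sums-to-1 σ)
    (symmetricNash⇒2[a+c]+1≤2[a+c][a+c+2b] σ nash)
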